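{- Let $w$ be a word, $F$ an $f$-factorization of $w$, and $v$ a quasiseed of $w$. Then for $\alpha=[2|v|+1..|w|-|v|]$ we have $|F_\alpha|\le\lfloor 2|w|/|v|\rfloor$.
   Context: A word $v$ is a cover of a word $y$ if every position of $y$ lies in some occurrence of $v$ in $y$. A subword $v$ of $w$ is a quasiseed of $w$ if $w=xyz$ with $|x|,|z|<|v|$ and $v$ is a cover of $y$. A factorization of $w$ is $F=(f_1,\dots,f_K)$ with $w=f_1\cdots f_K$ and each $f_k$ a subword of $f_1\cdots f_{k-1}$ or a single letter; an $f$-factorization has the minimum number of factors. For an interval $\alpha$ of positions, $F_\alpha$ is the set of factors of $F$ starting and ending within $\alpha$; $[a..b]=\{a,\dots,b\}$. -}

module Defs where

open import Data.Nat using (ℕ; zero; suc; _+_; _≤_; _<_; _≤?_)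
open import Data.List using (List; []; _∷_; _++_; length; drop; concat)
open import Data.Product using (Σ; ∃; _×_; _,_)
open import Data.Sum using (_⊎_)
open import Relation.Binary.PropositionalEquality using (_≡_)
open import Relation.Nullary using (yes; no)

-- Words over an alphabet A are lists; positions are 1-indexed in the paper.

Subword : {A : Set} → List A → List A → Set
Subword {A} u w = Σ (List A) λ x → Σ (List A) λ z → x ++ u ++ z ≡ w

-- v occurs in y starting at 0-based offset i (i.e. at 1-based position i+1)
OccursAt : {A : Set} → List A → List A → ℕ → Set
OccursAt {A} v y i = Σ (List A) λ z → drop i y ≡ v ++ z

Cover : {A : Set} → List A → List A → Set
Cover v y = (p : ℕ) → p < length y →
  Σ ℕ λ i → OccursAt v y i × i ≤ p × p < i + length v

Quasiseed : {A : Set} → List A → List A → Set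
Quasiseed {A} v w =
  Subword v w ×
  Σ (List A) λ x → Σ (List A) λ y → Σ (List A) λ z →
    (w ≡ x ++ y ++ z) × (length x < length v) × (length z < length v) × Cover v y

ValidFactors : {A : Set} → List A → List (List A) → Set
ValidFactors pre [] = Data.Unit.⊤
  where import Data.Unit
ValidFactors pre (f ∷ fs) = ((length f ≡ 1) ⊎ Subword f pre) × ValidFactors (pre ++ f) fs

Factorization : {A : Set} → List (List A) → List A → Set
Factorization F w = (concat F ≡ w) × ValidFactors [] F

FFactorization : {A : Set} → List (List A) → List A → Set
FFactorization {A} F w =
  Factorization F w × ((G : List (List A)) → Factorization G w → length F ≤ length G)

-- countFrom off a b F = number of factors of F (the first one starting at
-- 1-based position off+1) whose first and last positions both lie in [a..b].
-- A factor f starting at position s occupies [s .. s+|f|-1].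
countFrom : {A : Set} → ℕ → ℕ → ℕ → List (List A) → ℕ
countFrom off a b [] = 0
countFrom off a b (f ∷ fs) with a ≤? suc off | off + length f ≤? b
... | yes _ | yes _ = suc (countFrom (off + length f) a b fs)
... | _     | _     = countFrom (off + length f) a b fs

countIn : {A : Set} → ℕ → ℕ → List (List A) → ℕ
countIn a b F = countFrom 0 a b F

module Submission where

-- Every position of the middle part y of w = xyz lies in an
-- occurrence of v, and |x| < m, so v itself occurs inside the first 2m
-- letters.  Hence any window of w of length ≤ m that starts after position 2m
-- and ends before n - m splits into at most two pieces, each contained in an
-- occurrence of v and therefore a subword of the prefix of w preceding it.
-- Replacing the factors of F inside α by such pieces (two per block of m
-- letters, at most ⌊n/m⌋ blocks) gives a factorization of w with at most
-- |F| - |F_α| + 2⌊n/m⌋ factors, so minimality of F yields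
-- |F_α| ≤ 2⌊n/m⌋ ≤ ⌊2n/m⌋.

open import Defs
open import Data.Nat using (ℕ; NonZero; zero; suc; _+_; _*_; _∸_; _≤_; _<_; _≤?_; z≤n; s≤s; _/_; _%_)
open import Data.Nat.Properties
open import Data.Nat.DivMod using (m%n≤n; m%n≡m∸m/n*n; m/n*n≤m; m*n/n≡m; /-monoˡ-≤)
open import Data.Nat.Induction using (<-wellFounded)
open import Induction.WellFounded using (Acc; acc)
open import Data.List using (List; []; _∷_; _++_; length; take; drop; concat)
open import Data.List.Properties using (++-assoc; length-++; take++drop≡id; drop-drop; take-[])
open import Data.Product using (Σ; _×_; _,_; proj₁; proj₂)
open import Data.Sum using (_⊎_; inj₁; inj₂)
open import Data.Empty using (⊥-elim)
open import Relation.Nullary using (yes; no)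
open import Relation.Binary.PropositionalEquality

module _ {A : Set} where

  subword-trans : {u v t : List A} → Subword u v → Subword v t → Subword u t
  subword-trans {u} {v} {t} (x₁ , z₁ , e₁) (x₂ , z₂ , e₂) = (x₂ ++ x₁) , (z₁ ++ z₂) , eq
    where
      open ≡-Reasoning
      eq : (x₂ ++ x₁) ++ u ++ z₁ ++ z₂ ≡ t
      eq = begin
        (x₂ ++ x₁) ++ u ++ z₁ ++ z₂   ≡⟨ ++-assoc x₂ x₁ _ ⟩
        x₂ ++ x₁ ++ u ++ z₁ ++ z₂     ≡⟨ cong (λ q → x₂ ++ x₁ ++ q) (sym (++-assoc u z₁ z₂)) ⟩
        x₂ ++ x₁ ++ (u ++ z₁) ++ z₂   ≡⟨ cong (x₂ ++_) (sym (++-assoc x₁ (u ++ z₁) z₂)) ⟩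
        x₂ ++ (x₁ ++ u ++ z₁) ++ z₂   ≡⟨ cong (λ q → x₂ ++ q ++ z₂) e₁ ⟩
        x₂ ++ v ++ z₂                 ≡⟨ e₂ ⟩
        t                             ∎

  drop-length-++ : (f r : List A) → drop (length f) (f ++ r) ≡ r
  drop-length-++ []      r = refl
  drop-length-++ (x ∷ f) r = drop-length-++ f r

  take-length-++ : (f r : List A) → take (length f) (f ++ r) ≡ f
  take-length-++ []      r = refl
  take-length-++ (x ∷ f) r = cong (x ∷_) (take-length-++ f r)

  drop-++-≤ : ∀ i (u r : List A) → i ≤ length u → drop i (u ++ r) ≡ drop i u ++ r
  drop-++-≤ zero    u       r i≤ = refl
  drop-++-≤ (suc i) (x ∷ u) r (s≤s i≤) = drop-++-≤ i u r i≤

  take-+ : ∀ p q (xs : List A) → take (p + q) xs ≡ take p xs ++ take q (drop p xs)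
  take-+ zero    q xs       = refl
  take-+ (suc p) q []       = sym (take-[] q)
  take-+ (suc p) q (x ∷ xs) = cong (x ∷_) (take-+ p q xs)

  -- slice a c w: the letters of w at the (0-based) positions a, …, c-1.
  -- Note that slice 0 a w is definitionally take a w.
  slice : ℕ → ℕ → List A → List A
  slice a c w = take (c ∸ a) (drop a w)

  drop-drop-∸ : ∀ {a c} (w : List A) → a ≤ c → drop (c ∸ a) (drop a w) ≡ drop c w
  drop-drop-∸ {a} {c} w a≤c = trans (drop-drop a (c ∸ a) w) (cong (λ q → drop q w) (m+[n∸m]≡n a≤c))

  slice-++ : ∀ {a b c} (w : List A) → a ≤ b → b ≤ c → slice a b w ++ slice b c w ≡ slice a c w
  slice-++ {a} {b} {c} w a≤b b≤c = begin
      take (b ∸ a) (drop a w) ++ take (c ∸ b) (drop b w)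
        ≡⟨ cong (λ d → take (b ∸ a) (drop a w) ++ take (c ∸ b) d) (sym (drop-drop-∸ w a≤b)) ⟩
      take (b ∸ a) (drop a w) ++ take (c ∸ b) (drop (b ∸ a) (drop a w))
        ≡⟨ sym (take-+ (b ∸ a) (c ∸ b) (drop a w)) ⟩
      take ((b ∸ a) + (c ∸ b)) (drop a w)
        ≡⟨ cong (λ q → take q (drop a w)) lengths ⟩
      take (c ∸ a) (drop a w) ∎
    where
      open ≡-Reasoning
      lengths : (b ∸ a) + (c ∸ b) ≡ c ∸ a
      lengths = begin
        (b ∸ a) + (c ∸ b)   ≡⟨ +-comm (b ∸ a) (c ∸ b) ⟩
        (c ∸ b) + (b ∸ a)   ≡⟨ sym (+-∸-assoc (c ∸ b) a≤b) ⟩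
        (c ∸ b) + b ∸ a     ≡⟨ cong (_∸ a) (m∸n+n≡m b≤c) ⟩
        c ∸ a               ∎

  drop≡slice++drop : ∀ {a c} (w : List A) → a ≤ c → drop a w ≡ slice a c w ++ drop c w
  drop≡slice++drop {a} {c} w a≤c =
    trans (sym (take++drop≡id (c ∸ a) (drop a w))) (cong (slice a c w ++_) (drop-drop-∸ w a≤c))

  slice-at : ∀ s (w f r : List A) → drop s w ≡ f ++ r → slice s (s + length f) w ≡ f
  slice-at s w f r e = begin
      take (s + length f ∸ s) (drop s w)  ≡⟨ cong₂ take (m+n∸m≡n s (length f)) e ⟩
      take (length f) (f ++ r)            ≡⟨ take-length-++ f r ⟩
      f                                   ∎
    where open ≡-Reasoning

  drop-at : ∀ s (w f r : List A) → drop s w ≡ f ++ r → drop (s + length f) w ≡ r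
  drop-at s w f r e =
    trans (sym (drop-drop s (length f) w)) (trans (cong (drop (length f)) e) (drop-length-++ f r))

  slice-subword : ∀ {s a c e} (w : List A) → s ≤ a → a ≤ c → c ≤ e →
    Subword (slice a c w) (slice s e w)
  slice-subword {s} {a} {c} {e} w s≤a a≤c c≤e =
    slice s a w , slice c e w ,
    trans (cong (slice s a w ++_) (slice-++ w a≤c c≤e)) (slice-++ w s≤a (≤-trans a≤c c≤e))

  -- countFrom only counts factors ending at most at b, so it vanishes once
  -- the current offset is beyond b.
  countFrom-beyond : ∀ (F : List (List A)) off a b → b < off → countFrom off a b F ≡ 0
  countFrom-beyond []       off a b b<off = refl
  countFrom-beyond (f ∷ fs) off a b b<off with a ≤? suc off | off + length f ≤? b
  ... | yes _ | yes f≤b = ⊥-elim (<⇒≱ b<off (≤-trans (m≤m+n off (length f)) f≤b))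
  ... | yes _ | no _    = countFrom-beyond fs (off + length f) a b (<-≤-trans b<off (m≤m+n off (length f)))
  ... | no _  | _       = countFrom-beyond fs (off + length f) a b (<-≤-trans b<off (m≤m+n off (length f)))

module Windows (m : ℕ) (Occ : ℕ → Set) (lo hi : ℕ)
  (covered : ∀ p → lo ≤ p → p < hi → Σ ℕ λ s → Occ s × s ≤ p × p < s + m) where

  Inside : ℕ → ℕ → Set
  Inside x z = Σ ℕ λ s → Occ s × s ≤ x × z ≤ s + m

  SplitsInTwo : ℕ → ℕ → Set
  SplitsInTwo x z = Σ ℕ λ c → x ≤ c × c ≤ z × Inside x c × Inside c z

  -- Starting from a block s covering x: if it reaches z we are done;
  -- otherwise the block t covering s + m either still starts at or before x
  -- (then retry with t, which is closer to x) or starts after x, and then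
  -- [x, s + m) ⊆ [s, s + m) and [s + m, z) ⊆ [t, t + m).
  splitWindow : ∀ x z → lo ≤ x → x < z → z ≤ x + m → z ≤ hi → SplitsInTwo x z
  splitWindow x z lo≤x x<z z≤x+m z≤hi with covered x lo≤x (<-≤-trans x<z z≤hi)
  ... | s₀ , occ₀ , s₀≤x , x<s₀+m = search s₀ (<-wellFounded (x ∸ s₀)) occ₀ s₀≤x x<s₀+m
    where
      search : ∀ s → Acc _<_ (x ∸ s) → Occ s → s ≤ x → x < s + m → SplitsInTwo x z
      search s (acc closer) occ s≤x x<s+m with z ≤? s + m
      ... | yes z≤s+m =
        z , <⇒≤ x<z , ≤-refl , (s , occ , s≤x , z≤s+m) , (s , occ , ≤-trans s≤x (<⇒≤ x<z) , z≤s+m)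
      ... | no z≰s+m with covered (s + m) (≤-trans lo≤x (<⇒≤ x<s+m)) (<-≤-trans (≰⇒> z≰s+m) z≤hi)
      ...   | t , occt , t≤s+m , s+m<t+m with t ≤? x
      ...     | yes t≤x = search t (closer (∸-monoʳ-< s<t t≤x)) occt t≤x (<-≤-trans x<s+m (<⇒≤ s+m<t+m))
        where
          s<t : s < t
          s<t = +-cancelʳ-< m s t s+m<t+m
      ...     | no t≰x =
        (s + m) , <⇒≤ x<s+m , <⇒≤ (≰⇒> z≰s+m) , (s , occ , s≤x , ≤-refl) ,
        (t , occt , t≤s+m , ≤-trans z≤x+m (+-monoˡ-≤ m (<⇒≤ (≰⇒> t≰x))))

∸-divisor≤quotient*divisor : ∀ n m .{{_ : NonZero m}} → n ∸ m ≤ (n / m) * m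
∸-divisor≤quotient*divisor n m = begin
    n ∸ m               ≤⟨ ∸-monoʳ-≤ n (m%n≤n n m) ⟩
    n ∸ n % m           ≡⟨ cong (n ∸_) (m%n≡m∸m/n*n n m) ⟩
    n ∸ (n ∸ n / m * m) ≡⟨ m∸[m∸n]≡n (m/n*n≤m n m) ⟩
    n / m * m           ∎
  where open ≤-Reasoning

double-quotient : ∀ n m .{{_ : NonZero m}} → 2 * (n / m) ≤ (2 * n) / m
double-quotient n m = begin
    2 * (n / m)          ≡⟨ sym (m*n/n≡m (2 * (n / m)) m) ⟩
    2 * (n / m) * m / m  ≤⟨ /-monoˡ-≤ m (≤-trans (≤-reflexive (*-assoc 2 (n / m) m)) (*-monoʳ-≤ 2 (m/n*n≤m n m))) ⟩
    (2 * n) / m          ∎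
  where open ≤-Reasoning

module Suffixes {A : Set} (w : List A) where

  Suffix : ℕ → List (List A) → Set
  Suffix off fs = ValidFactors (take off w) fs × concat fs ≡ drop off w

  Tail : ℕ → ℕ → Set
  Tail x k = Σ (List (List A)) λ G → Suffix x G × length G ≤ k

  Suffix⇒Tail : ∀ {off fs} → Suffix off fs → Tail off (length fs)
  Suffix⇒Tail {fs = fs} suf = fs , suf , ≤-refl

  Tail-mono : ∀ {x k k′} → k ≤ k′ → Tail x k → Tail x k′
  Tail-mono k≤k′ (G , suf , G≤k) = G , suf , ≤-trans G≤k k≤k′

  Tail-cons : ∀ {a c k} (f : List A) → a ≤ c → f ≡ slice a c w →
    (length f ≡ 1 ⊎ Subword f (take a w)) → Tail c k → Tail a (suc k)
  Tail-cons {a} {c} f a≤c refl valid (G , (validG , concatG) , G≤k) =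
    (f ∷ G) , ((valid , validG′) , concat-eq) , s≤s G≤k
    where
      validG′ : ValidFactors (take a w ++ f) G
      validG′ = subst (λ p → ValidFactors p G) (sym (slice-++ w z≤n a≤c)) validG
      concat-eq : f ++ concat G ≡ drop a w
      concat-eq = trans (cong (f ++_) concatG) (sym (drop≡slice++drop w a≤c))

  peel : ∀ {off f fs} → Suffix off (f ∷ fs) →
    f ≡ slice off (off + length f) w × Suffix (off + length f) fs
  peel {off} {f} {fs} ((_ , validFs) , concatEq) = f≡slice , validFs′ , sym (drop-at off w f (concat fs) (sym concatEq))
    where
      f≡slice : f ≡ slice off (off + length f) w
      f≡slice = sym (slice-at off w f (concat fs) (sym concatEq))
      prefixEq : take off w ++ f ≡ take (off + length f) w
      prefixEq = trans (cong (take off w ++_) f≡slice) (slice-++ w z≤n (m≤m+n off (length f)))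
      validFs′ : ValidFactors (take (off + length f) w) fs
      validFs′ = subst (λ p → ValidFactors p fs) prefixEq validFs

  -- Suppose that from every x with a ≤ x + 1
  -- the suffix from any y ≥ x that is x itself or ≤ b can be reached with
  -- `cost` extra factors.  Then the factors counted by countFrom can be
  -- traded for `cost` factors.
  module ReplaceBlock (a b cost : ℕ)
    (bridge : ∀ {x y k} → a ≤ suc x → x ≤ y → (y ≡ x ⊎ y ≤ b) → Tail y k → Tail x (cost + k)) where

    skipBlock : ∀ off fs → a ≤ suc off → Suffix off fs →
      Σ ℕ λ y → Σ ℕ λ k → Tail y k × k + countFrom off a b fs ≤ length fs × off ≤ y × (y ≡ off ⊎ y ≤ b)
    skipBlock off [] a≤ suf = off , 0 , Suffix⇒Tail suf , z≤n , ≤-refl , inj₁ refl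
    skipBlock off (f ∷ fs) a≤ suf with a ≤? suc off | off + length f ≤? b
    ... | no a≰ | _ = ⊥-elim (a≰ a≤)
    ... | yes _ | no f≰b = off , suc (length fs) , Suffix⇒Tail suf , nothingCounted , ≤-refl , inj₁ refl
      where
        nothingCounted : suc (length fs) + countFrom (off + length f) a b fs ≤ suc (length fs)
        nothingCounted = ≤-reflexive (trans (cong (suc (length fs) +_)
          (countFrom-beyond fs (off + length f) a b (≰⇒> f≰b))) (+-identityʳ _))
    ... | yes _ | yes f≤b with skipBlock (off + length f) fs (≤-trans a≤ (s≤s (m≤m+n off (length f)))) (proj₂ (peel suf))
    ...   | y , k , tail , counted , off′≤y , reach =
      y , k , tail , ≤-trans (≤-reflexive (+-suc k _)) (s≤s counted) , ≤-trans (m≤m+n off (length f)) off′≤y , reach′ reach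
      where
        reach′ : (y ≡ off + length f ⊎ y ≤ b) → (y ≡ off ⊎ y ≤ b)
        reach′ (inj₁ y≡) = inj₂ (subst (_≤ b) (sym y≡) f≤b)
        reach′ (inj₂ y≤b) = inj₂ y≤b

    -- Keep the factors before the block, bridge over the block, keep the rest.
    shorten : ∀ off fs → Suffix off fs → Σ ℕ λ k → Tail off k × k + countFrom off a b fs ≤ length fs + cost
    shorten off fs suf with a ≤? suc off
    shorten off fs suf | yes a≤ with skipBlock off fs a≤ suf
    ... | y , k , tail , counted , off≤y , reach = cost + k , bridge a≤ off≤y reach tail , total
      where
        open ≤-Reasoning
        total : cost + k + countFrom off a b fs ≤ length fs + cost
        total = begin
          cost + k + countFrom off a b fs    ≡⟨ +-assoc cost k _ ⟩
          cost + (k + countFrom off a b fs)  ≤⟨ +-monoʳ-≤ cost counted ⟩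
          cost + length fs                   ≡⟨ +-comm cost (length fs) ⟩
          length fs + cost                   ∎
    shorten off [] suf | no _ = 0 , Suffix⇒Tail suf , z≤n
    shorten off (f ∷ fs) suf | no a≰ with a ≤? suc off | off + length f ≤? b
    ... | yes a≤ | _ = ⊥-elim (a≰ a≤)
    ... | no _ | _ with peel suf
    ...   | f≡slice , rest with shorten (off + length f) fs rest
    ...     | k , tail , counted =
      suc k , Tail-cons f (m≤m+n off (length f)) f≡slice (proj₁ (proj₁ suf)) tail , s≤s counted

module QuasiseedSetting {A : Set} (w v X Y Z : List A) (w≡XYZ : w ≡ X ++ Y ++ Z)
  (X<v : length X < length v) (Z<v : length Z < length v) (cover : Cover v Y)
  .{{_ : NonZero (length v)}} where

  open Suffixes w

  m n lx ly : ℕ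
  m = length v
  n = length w
  lx = length X
  ly = length Y

  Occ : ℕ → Set
  Occ s = Σ (List A) λ r → drop s w ≡ v ++ r

  shift-occurrence : ∀ i r → i ≤ ly → drop i Y ≡ v ++ r → Occ (lx + i)
  shift-occurrence i r i≤ly dropY = r ++ Z , (begin
      drop (lx + i) w                   ≡⟨ cong (drop (lx + i)) w≡XYZ ⟩
      drop (lx + i) (X ++ Y ++ Z)       ≡⟨ sym (drop-drop lx i (X ++ Y ++ Z)) ⟩
      drop i (drop lx (X ++ Y ++ Z))    ≡⟨ cong (drop i) (drop-length-++ X (Y ++ Z)) ⟩
      drop i (Y ++ Z)                   ≡⟨ drop-++-≤ i Y Z i≤ly ⟩
      drop i Y ++ Z                     ≡⟨ cong (_++ Z) dropY ⟩
      (v ++ r) ++ Z                     ≡⟨ ++-assoc v r Z ⟩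
      v ++ r ++ Z                       ∎)
    where open ≡-Reasoning

  covered : ∀ p → lx ≤ p → p < lx + ly → Σ ℕ λ s → Occ s × s ≤ p × p < s + m
  covered p lx≤p p<end = shift (cover q q<ly)
    where
      q : ℕ
      q = p ∸ lx
      lx+q≡p : lx + q ≡ p
      lx+q≡p = m+[n∸m]≡n lx≤p
      q<ly : q < ly
      q<ly = +-cancelˡ-< lx q ly (subst (_< lx + ly) (sym lx+q≡p) p<end)
      shift : (Σ ℕ λ i → OccursAt v Y i × i ≤ q × q < i + m) → Σ ℕ λ s → Occ s × s ≤ p × p < s + m
      shift (i , (r , dropY) , i≤q , q<i+m) =
        lx + i , shift-occurrence i r (<⇒≤ (≤-<-trans i≤q q<ly)) dropY ,
        subst (lx + i ≤_) lx+q≡p (+-monoʳ-≤ lx i≤q) ,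
        subst₂ _<_ lx+q≡p (sym (+-assoc lx i m)) (+-monoʳ-< lx q<i+m)

  -- The covered region extends at least to n - m, since |Z| < m.
  n∸m≤lx+ly : n ∸ m ≤ lx + ly
  n∸m≤lx+ly = begin
      n ∸ m                            ≤⟨ ∸-monoʳ-≤ n (<⇒≤ Z<v) ⟩
      n ∸ length Z                     ≡⟨ cong (_∸ length Z) lengths ⟩
      lx + ly + length Z ∸ length Z    ≡⟨ m+n∸n≡m (lx + ly) (length Z) ⟩
      lx + ly                          ∎
    where
      open ≤-Reasoning
      lengths : n ≡ lx + ly + length Z
      lengths = trans (cong length w≡XYZ)
        (trans (length-++ X) (trans (cong (lx +_) (length-++ Y)) (sym (+-assoc lx ly (length Z)))))

  open Windows m Occ lx (lx + ly) covered

  -- Since |X| < m, the occurrence of v covering position |X| ends before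
  -- position |X| + m; so v is a subword of every prefix at least that long.
  v⊑prefix : ∀ {a} → lx < lx + ly → lx + m ≤ a → Subword v (take a w)
  v⊑prefix {a} lx<end lx+m≤a with covered lx ≤-refl lx<end
  ... | s , (r , occ) , s≤lx , _ =
    subst (λ u → Subword u (take a w)) (slice-at s w v r occ)
      (slice-subword w z≤n (m≤m+n s m) (≤-trans (+-monoˡ-≤ m s≤lx) lx+m≤a))

  inside⊑v : ∀ {a c} → a ≤ c → Inside a c → Subword (slice a c w) v
  inside⊑v a≤c (s , (r , occ) , s≤a , c≤s+m) =
    subst (Subword _) (slice-at s w v r occ) (slice-subword w s≤a a≤c c≤s+m)

  beyond-2m : ∀ {x} → 2 * m ≤ x → lx + m ≤ x
  beyond-2m 2m≤x = ≤-trans (+-monoˡ-≤ m (<⇒≤ X<v)) (≤-trans (≤-reflexive (cong (m +_) (sym (+-identityʳ m)))) 2m≤x)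

  window : ∀ {x z k} → 2 * m ≤ x → x ≤ z → z ≤ x + m → (z ≡ x ⊎ z ≤ n ∸ m) → Tail z k → Tail x (2 + k)
  window {k = k} 2m≤x x≤z z≤x+m (inj₁ refl) tail = Tail-mono (m≤n+m k 2) tail
  window {x} {z} {k} 2m≤x x≤z z≤x+m (inj₂ z≤b) tail with m≤n⇒m<n∨m≡n x≤z
  ... | inj₂ refl = Tail-mono (m≤n+m k 2) tail
  ... | inj₁ x<z with splitWindow x z lx≤x x<z z≤x+m (≤-trans z≤b n∸m≤lx+ly)
    where
      lx≤x : lx ≤ x
      lx≤x = m+n≤o⇒m≤o lx (beyond-2m 2m≤x)
  ...   | c , x≤c , c≤z , inside₁ , inside₂ =
    Tail-cons (slice x c w) x≤c refl (inj₂ (piece x≤c ≤-refl inside₁))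
      (Tail-cons (slice c z w) c≤z refl (inj₂ (piece c≤z x≤c inside₂)) tail)
    where
      lx<end : lx < lx + ly
      lx<end = <-≤-trans (≤-<-trans (m+n≤o⇒m≤o lx (beyond-2m 2m≤x)) x<z) (≤-trans z≤b n∸m≤lx+ly)
      piece : ∀ {a e} → a ≤ e → x ≤ a → Inside a e → Subword (slice a e w) (take a w)
      piece a≤e x≤a inside =
        subword-trans (inside⊑v a≤e inside) (v⊑prefix lx<end (≤-trans (beyond-2m 2m≤x) x≤a))

  two-more-blocks : ∀ j k → 2 + (2 * j + k) ≡ 2 * suc j + k
  two-more-blocks j k = trans (sym (+-assoc 2 (2 * j) k)) (cong (_+ k) (sym (*-suc 2 j)))

  bridge-blocks : ∀ j {x y k} → 2 * m ≤ x → x ≤ y → (y ≡ x ⊎ y ≤ n ∸ m) → y ∸ x ≤ j * m →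
    Tail y k → Tail x (2 * j + k)
  bridge-blocks zero {x} {y} {k} 2m≤x x≤y reach gap tail =
    subst (λ q → Tail q k) (≤-antisym (m∸n≡0⇒m≤n (n≤0⇒n≡0 gap)) x≤y) tail
  bridge-blocks (suc j) {x} {y} {k} 2m≤x x≤y reach gap tail with y ≤? x + m
  ... | yes y≤x+m =
    Tail-mono (≤-trans (+-monoʳ-≤ 2 (m≤n+m k (2 * j))) (≤-reflexive (two-more-blocks j k)))
      (window 2m≤x x≤y y≤x+m reach tail)
  ... | no y≰x+m =
    Tail-mono (≤-reflexive (two-more-blocks j k))
      (window 2m≤x (m≤m+n x m) ≤-refl (inj₂ (≤-trans (<⇒≤ x+m<y) y≤b))
        (bridge-blocks j (≤-trans 2m≤x (m≤m+n x m)) (<⇒≤ x+m<y) (inj₂ y≤b) gap′ tail))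
    where
      open ≤-Reasoning
      x+m<y : x + m < y
      x+m<y = ≰⇒> y≰x+m
      -- y is not x, as it lies beyond x + m
      bounded : (y ≡ x ⊎ y ≤ n ∸ m) → y ≤ n ∸ m
      bounded (inj₁ refl) = ⊥-elim (y≰x+m (m≤m+n x m))
      bounded (inj₂ y≤b) = y≤b
      y≤b : y ≤ n ∸ m
      y≤b = bounded reach
      gap′ : y ∸ (x + m) ≤ j * m
      gap′ = begin
        y ∸ (x + m)      ≡⟨ sym (∸-+-assoc y x m) ⟩
        y ∸ x ∸ m        ≤⟨ ∸-monoˡ-≤ m gap ⟩
        suc j * m ∸ m    ≡⟨ m+n∸m≡n m (j * m) ⟩
        j * m            ∎

  bridge : ∀ {x y k} → 2 * m + 1 ≤ suc x → x ≤ y → (y ≡ x ⊎ y ≤ n ∸ m) → Tail y k → Tail x (2 * (n / m) + k)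
  bridge {x} {y} a≤ x≤y reach = bridge-blocks (n / m) 2m≤x x≤y reach (gap reach)
    where
      2m≤x : 2 * m ≤ x
      2m≤x = ≤-pred (subst (_≤ suc x) (+-comm (2 * m) 1) a≤)
      gap : (y ≡ x ⊎ y ≤ n ∸ m) → y ∸ x ≤ (n / m) * m
      gap (inj₁ refl) = subst (_≤ (n / m) * m) (sym (n∸n≡0 x)) z≤n
      gap (inj₂ y≤b) = ≤-trans (m∸n≤m y x) (≤-trans y≤b (∸-divisor≤quotient*divisor n m))

  open ReplaceBlock (2 * m + 1) (n ∸ m) (2 * (n / m)) bridge

  shorter-factorization : ∀ F → Factorization F w →
    Σ ℕ λ k → Tail 0 k × k + countIn (2 * m + 1) (n ∸ m) F ≤ length F + 2 * (n / m)
  shorter-factorization F (concatF , validF) = shorten 0 F (validF , concatF)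

mainTheorem7 : {A : Set} (w v : List A) (F : List (List A)) →
    FFactorization F w → Quasiseed v w → .{{_ : NonZero (length v)}} →
    countIn (2 * length v + 1) (length w ∸ length v) F ≤ (2 * length w) / length v
mainTheorem7 w v F (factF , minimal) (_ , X , Y , Z , w≡XYZ , X<v , Z<v , cover)
  with QuasiseedSetting.shorter-factorization w v X Y Z w≡XYZ X<v Z<v cover F factF
... | k , (G , (validG , concatG) , G≤k) , shortened = begin
    count                      ≤⟨ +-cancelˡ-≤ k count (2 * blocks) k+count≤k+2blocks ⟩
    2 * blocks                 ≤⟨ double-quotient (length w) (length v) ⟩
    (2 * length w) / length v  ∎
  where
    open ≤-Reasoning
    blocks count : ℕ
    blocks = length w / length v
    count = countIn (2 * length v + 1) (length w ∸ length v) F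
    -- minimality of F: |F| ≤ |G| ≤ k
    k+count≤k+2blocks : k + count ≤ k + 2 * blocks
    k+count≤k+2blocks = ≤-trans shortened (+-monoˡ-≤ (2 * blocks) (≤-trans (minimal G (concatG , validG)) G≤k))
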